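{- For every integer $k\ge0$: (a) $\gcd(F_{6k+1}-1,\,F_{6k+3})=2$; (b) $\gcd(F_{6k+3}-1,\,F_{6k+5})=1$. For every integer $k\ge1$: (c) $\gcd(F_{6k-1}-1,\,F_{6k+1})=1$.
   Context: $F_k$ denotes the $k$-th Fibonacci number, $F_0=0$, $F_1=F_2=1$, $F_k=F_{k-1}+F_{k-2}$. -}

module Defs where

open import Data.Nat using (ℕ; zero; suc; _+_)

F : ℕ → ℕ
F zero = 0
F (suc zero) = 1
F (suc (suc n)) = F (suc n) + F n

-- For odd n, Cassini's identity F n · F (n+2) = F (n+1)² + 1 together with F (n+2) = F (n+1) + F n
-- says that (x, y) = (F n, F (n+2)) solves x² + y² + 1 = 3xy. A common divisor d of x − 1 and y
-- sees x ≡ 1, y ≡ 0, hence d ∣ 2. Whether the gcd is 2 or 1 is then decided by parity: F m is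
-- even exactly when 3 ∣ m, so F (6k+3) is even and F (6k+1) − 1 is even, while F (6k+5) and
-- F (6k+7) are odd.
module Submission where

open import Defs
open import Data.Nat using (ℕ; zero; suc; _+_; _*_; _∸_; _%_; _/_; s≤s)
open import Data.Nat.DivMod using (m≡m%n+[m/n]*n; [m+kn]%n≡m%n)
open import Data.Nat.Divisibility
  using (_∣_; divides; ∣-antisym; ∣m∣n⇒∣m+n; ∣m+n∣m⇒∣n; ∣m⇒∣m*n; ∣n⇒∣m*n; 0∣⇒≡0; ∣⇒≤; m%n≡0⇒n∣m; n∣m⇒m%n≡0)
open import Data.Nat.GCD using (gcd; gcd[m,n]∣m; gcd[m,n]∣n; gcd-greatest)
open import Data.Nat.Properties using (+-identityʳ; *-suc; *-assoc; m+1+n≢0)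
open import Data.Nat.Tactic.RingSolver using (solve-∀)
open import Data.Product using (_×_; _,_)
open import Relation.Binary.PropositionalEquality
open import Relation.Nullary using (contradiction)

-- Cassini's identity F n · F (n+2) − F (n+1)² = (−1)ⁿ⁺¹ over ℕ: the sign is carried by the
-- summands e, f ∈ {0, 1}, which swap sides at every step.
cassini-step : ∀ n {e f} → F n * F (2 + n) + e ≡ F (1 + n) * F (1 + n) + f →
               F (1 + n) * F (3 + n) + f ≡ F (2 + n) * F (2 + n) + e
cassini-step n {e} {f} eq = begin
  y * (y + x + y) + f               ≡⟨ expand x y f ⟩
  y * y + y * x + (y * y + f)       ≡⟨ cong (y * y + y * x +_) eq ⟨
  y * y + y * x + (x * (y + x) + e) ≡⟨ collect x y e ⟩
  (y + x) * (y + x) + e             ∎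
  where
  open ≡-Reasoning
  x = F n
  y = F (1 + n)
  expand : ∀ x y f → y * (y + x + y) + f ≡ y * y + y * x + (y * y + f)
  expand = solve-∀
  collect : ∀ x y e → y * y + y * x + (x * (y + x) + e) ≡ (y + x) * (y + x) + e
  collect = solve-∀

cassini-even : ∀ m → F (2 * m) * F (2 + 2 * m) + 1 ≡ F (1 + 2 * m) * F (1 + 2 * m) + 0
cassini-even zero    = refl
cassini-even (suc m) =
  subst (λ n → F n * F (2 + n) + 1 ≡ F (1 + n) * F (1 + n) + 0) (sym (*-suc 2 m))
        (cassini-step (1 + 2 * m) (cassini-step (2 * m) (cassini-even m)))

cassini-odd : ∀ m → F (1 + 2 * m) * F (3 + 2 * m) ≡ F (2 + 2 * m) * F (2 + 2 * m) + 1
cassini-odd m = trans (sym (+-identityʳ _)) (cassini-step (2 * m) (cassini-even m))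

markov-of-cassini : ∀ x c → x * (c + x) ≡ c * c + 1 → x * x + (c + x) * (c + x) + 1 ≡ 3 * x * (c + x)
markov-of-cassini x c eq = begin
  x * x + (c + x) * (c + x) + 1       ≡⟨ expand x c ⟩
  2 * x * x + 2 * c * x + (c * c + 1) ≡⟨ cong (2 * x * x + 2 * c * x +_) eq ⟨
  2 * x * x + 2 * c * x + x * (c + x) ≡⟨ collect x c ⟩
  3 * x * (c + x)                     ∎
  where
  open ≡-Reasoning
  expand : ∀ x c → x * x + (c + x) * (c + x) + 1 ≡ 2 * x * x + 2 * c * x + (c * c + 1)
  expand = solve-∀
  collect : ∀ x c → 2 * x * x + 2 * c * x + x * (c + x) ≡ 3 * x * (c + x)
  collect = solve-∀

markov-common-divisor∣2 : ∀ {d} x y → x * x + y * y + 1 ≡ 3 * x * y → d ∣ x ∸ 1 → d ∣ y → d ∣ 2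
markov-common-divisor∣2 zero    y eq _   _   = contradiction eq (m+1+n≢0 (y * y))
markov-common-divisor∣2 {d} (suc a) y eq d∣a d∣y = ∣m+n∣m⇒∣n d∣[a*[2+a]+y*y]+2 d∣a*[2+a]+y*y
  where
  shift : ∀ a y → suc a * suc a + y * y + 1 ≡ a * (2 + a) + y * y + 2
  shift = solve-∀
  d∣[a*[2+a]+y*y]+2 : d ∣ a * (2 + a) + y * y + 2
  d∣[a*[2+a]+y*y]+2 = subst (d ∣_) (trans (sym eq) (shift a y)) (∣n⇒∣m*n (3 * suc a) d∣y)
  d∣a*[2+a]+y*y : d ∣ a * (2 + a) + y * y
  d∣a*[2+a]+y*y = ∣m∣n⇒∣m+n (∣m⇒∣m*n (2 + a) d∣a) (∣m⇒∣m*n y d∣y)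

gcd[F[1+2m]∸1,F[3+2m]]∣2 : ∀ m → gcd (F (1 + 2 * m) ∸ 1) (F (3 + 2 * m)) ∣ 2
gcd[F[1+2m]∸1,F[3+2m]]∣2 m =
  markov-common-divisor∣2 x y (markov-of-cassini x (F (2 + 2 * m)) (cassini-odd m))
    (gcd[m,n]∣m (x ∸ 1) y) (gcd[m,n]∣n (x ∸ 1) y)
  where
  x = F (1 + 2 * m)
  y = F (3 + 2 * m)

F[3+n]%2≡F[n]%2 : ∀ n → F (3 + n) % 2 ≡ F n % 2
F[3+n]%2≡F[n]%2 n =
  trans (cong (_% 2) (regroup (F n) (F (1 + n)))) ([m+kn]%n≡m%n (F n) (F (1 + n)) 2)
  where
  regroup : ∀ x y → y + x + y ≡ x + y * 2
  regroup = solve-∀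

F[3j+r]%2≡F[r]%2 : ∀ j r → F (3 * j + r) % 2 ≡ F r % 2
F[3j+r]%2≡F[r]%2 zero    r = refl
F[3j+r]%2≡F[r]%2 (suc j) r = begin
  F (3 * suc j + r) % 2   ≡⟨ cong (λ n → F (n + r) % 2) (*-suc 3 j) ⟩
  F (3 + (3 * j + r)) % 2 ≡⟨ F[3+n]%2≡F[n]%2 (3 * j + r) ⟩
  F (3 * j + r) % 2       ≡⟨ F[3j+r]%2≡F[r]%2 j r ⟩
  F r % 2                 ∎
  where open ≡-Reasoning

F[6k+r]%2≡F[r]%2 : ∀ k r → F (6 * k + r) % 2 ≡ F r % 2
F[6k+r]%2≡F[r]%2 k r =
  subst (λ n → F (n + r) % 2 ≡ F r % 2) (sym (*-assoc 3 2 k)) (F[3j+r]%2≡F[r]%2 (2 * k) r)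

odd⇒2∣pred : ∀ x → x % 2 ≡ 1 → 2 ∣ x ∸ 1
odd⇒2∣pred x odd =
  divides (x / 2) (cong (_∸ 1) (trans (m≡m%n+[m/n]*n x 2) (cong (_+ (x / 2) * 2) odd)))

gcd∣2⇒gcd≡1 : ∀ a b → gcd a b ∣ 2 → b % 2 ≡ 1 → gcd a b ≡ 1
gcd∣2⇒gcd≡1 a b gcd∣2 b-odd with gcd a b | gcd∣2 | gcd[m,n]∣n a b
... | zero              | 0∣2 | _   = contradiction (0∣⇒≡0 0∣2) λ ()
... | 1                 | _   | _   = refl
... | 2                 | _   | 2∣b = contradiction (trans (sym (n∣m⇒m%n≡0 b 2 2∣b)) b-odd) λ ()
... | suc (suc (suc _)) | d∣2 | _ with ∣⇒≤ d∣2
...   | s≤s (s≤s ())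

gcd[F[n]∸1,F[n′]]∣2 : ∀ m {n n′} → 1 + 2 * m ≡ n → 3 + 2 * m ≡ n′ → gcd (F n ∸ 1) (F n′) ∣ 2
gcd[F[n]∸1,F[n′]]∣2 m refl refl = gcd[F[1+2m]∸1,F[3+2m]]∣2 m

1+2[r+3k]≡6k+[1+2r] : ∀ k r → 1 + 2 * (r + 3 * k) ≡ 6 * k + (1 + 2 * r)
1+2[r+3k]≡6k+[1+2r] = solve-∀

3+2[r+3k]≡6k+[3+2r] : ∀ k r → 3 + 2 * (r + 3 * k) ≡ 6 * k + (3 + 2 * r)
3+2[r+3k]≡6k+[3+2r] = solve-∀

gcd[F[6k+1]∸1,F[6k+3]]≡2 : ∀ k → gcd (F (6 * k + 1) ∸ 1) (F (6 * k + 3)) ≡ 2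
gcd[F[6k+1]∸1,F[6k+3]]≡2 k =
  ∣-antisym (gcd[F[n]∸1,F[n′]]∣2 (3 * k) (1+2[r+3k]≡6k+[1+2r] k 0) (3+2[r+3k]≡6k+[3+2r] k 0))
    (gcd-greatest (odd⇒2∣pred (F (6 * k + 1)) (F[6k+r]%2≡F[r]%2 k 1))
                  (m%n≡0⇒n∣m (F (6 * k + 3)) 2 (F[6k+r]%2≡F[r]%2 k 3)))

gcd[F[6k+3]∸1,F[6k+5]]≡1 : ∀ k → gcd (F (6 * k + 3) ∸ 1) (F (6 * k + 5)) ≡ 1
gcd[F[6k+3]∸1,F[6k+5]]≡1 k = gcd∣2⇒gcd≡1 (F (6 * k + 3) ∸ 1) (F (6 * k + 5))
  (gcd[F[n]∸1,F[n′]]∣2 (1 + 3 * k) (1+2[r+3k]≡6k+[1+2r] k 1) (3+2[r+3k]≡6k+[3+2r] k 1))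
  (F[6k+r]%2≡F[r]%2 k 5)

gcd[F[6k+5]∸1,F[6k+7]]≡1 : ∀ k → gcd (F (6 * suc k ∸ 1) ∸ 1) (F (6 * suc k + 1)) ≡ 1
gcd[F[6k+5]∸1,F[6k+7]]≡1 k = gcd∣2⇒gcd≡1 (F (6 * suc k ∸ 1) ∸ 1) (F (6 * suc k + 1))
  (gcd[F[n]∸1,F[n′]]∣2 (2 + 3 * k) (cong (_∸ 1) (2+2[2+3k]≡6[1+k] k)) (3+2[2+3k]≡6[1+k]+1 k))
  (F[6k+r]%2≡F[r]%2 (suc k) 1)
  where
  2+2[2+3k]≡6[1+k] : ∀ k → 2 + 2 * (2 + 3 * k) ≡ 6 * suc k
  2+2[2+3k]≡6[1+k] = solve-∀
  3+2[2+3k]≡6[1+k]+1 : ∀ k → 3 + 2 * (2 + 3 * k) ≡ 6 * suc k + 1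
  3+2[2+3k]≡6[1+k]+1 = solve-∀

lemma18 : ((k : ℕ) → gcd (F (6 * k + 1) ∸ 1) (F (6 * k + 3)) ≡ 2)
          × ((k : ℕ) → gcd (F (6 * k + 3) ∸ 1) (F (6 * k + 5)) ≡ 1)
          × ((k : ℕ) → gcd (F (6 * suc k ∸ 1) ∸ 1) (F (6 * suc k + 1)) ≡ 1)
lemma18 = gcd[F[6k+1]∸1,F[6k+3]]≡2 , gcd[F[6k+3]∸1,F[6k+5]]≡1 , gcd[F[6k+5]∸1,F[6k+7]]≡1
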